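{- Let $k\ge2$. For terms $\alpha,\beta\in OT_0$: if $G_0(\alpha)<\beta$ then $G_1(o_k(\alpha))<o_k(\beta)$.
   Context: Ordinal terms. Let $T$ be the set of formal terms generated by: $0,1\in T$; if $\beta\in T$ then $\psi_0\beta,\psi_1\beta,\psi_2\beta\in T$ (these and $1$ are the principal terms); if $\alpha_0\ge\dots\ge\alpha_n$ ($n\ge1$) are principal terms then $\alpha_0+\dots+\alpha_n\in T$. The linear order $<$ on $T$ is generated by: $0<\alpha$ for $\alpha\ne0$; $1<\psi_i\beta$; $\psi_i\alpha<\psi_i\beta$ if $\alpha<\beta$; $\psi_i\alpha<\psi_j\beta$ if $i<j$; sums (a principal term counting as a sum of length one) are compared lexicographically. Abbreviations: $\omega:=\psi_00$, $\Omega:=\psi_10$, $\Omega_2:=\psi_20$; a natural number $n$ is identified with $1+\dots+1$; $+$ between terms is term addition and $\alpha\cdot x$ is the $x$-fold sum. For a set $A$ of terms, $A<\beta$ means every element of $A$ is $<\beta$. Sets $G_0,G_1$: $G_1\alpha=\emptyset$ if $\alpha<\Omega$; $G_1\psi_2\beta=G_1\beta$; $G_1$ of a sum is the union over summands; $G_1\psi_1\beta=\{\beta\}\cup G_1\beta$; $G_1\psi_0\beta=\emptyset$. $G_00=G_01=\emptyset$; $G_0\psi_2\beta=G_0\beta$; $G_0$ of a sum is the union; $G_0\psi_1\beta=G_0\beta$; $G_0\psi_0\beta=\{\beta\}\cup G_0\beta$. $OT\subseteq T$: $0,1\in OT$; $\psi_2\beta\in OT$ if $\beta\in OT$; a sum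 is in $OT$ if all summands are; $\psi_1\beta\in OT$ if $\beta\in OT$ and $G_1\beta<\beta$; $\psi_0\beta\in OT$ if $\beta\in OT$, $G_0\beta<\beta$, $\beta<\Omega_2$. $\varepsilon_{\Omega+1}$ denotes $\psi_1\Omega_2$, and $OT_0:=\{\alpha\in OT:\alpha<\varepsilon_{\Omega+1},\ G_0\alpha<\varepsilon_{\Omega+1}\}$. Fundamental sequences: $tp(0)=0$; $tp(1)=1$, $1[0]=0$; for $\Omega_0:=\omega,\Omega_1:=\Omega,\Omega_2$: $tp(\Omega_i)=\Omega_i$, $\Omega_i[x]=x$; for a sum $\alpha_0+\dots+\alpha_n$ ($n\ge1$): $tp=tp(\alpha_n)$, $(\alpha_0+\dots+\alpha_n)[x]=\alpha_0+\dots+\alpha_{n-1}+\alpha_n[x]$; if $tp(\alpha)=1$: $tp(\psi_i\alpha)=\omega$, $(\psi_i\alpha)[x]=\psi_i(\alpha[0])\cdot x$; if $tp(\alpha)\notin\{0,1\}$ and ($i=2$ or $tp(\alpha)<\Omega_{i+1}$): $tp(\psi_i\alpha)=tp(\alpha)$, $(\psi_i\alpha)[x]=\psi_i(\alpha[x])$; if $tp(\alpha)=\Omega$: $tp(\psi_0\alpha)=\omega$, $(\psi_0\alpha)[x]=\psi_0(\alpha[z_x])$, $z_0=0$, $z_{x+1}=\psi_0(\alpha[z_x])$; if $tp(\alpha)=\Omega_2$: $tp(\psi_1\alpha)=\omega$, $(\psi_1\alpha)[x]=\psi_1(\alpha[z_x])$, $z_0=0$, $z_{x+1}=\psi_1(\alpha[z_x])$.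 Conventions: $0[x]=0$, $(\alpha+1)[x]=\alpha$, if $tp(\alpha)\in\{0,1\}$ then $\alpha[m]=\alpha[0]$. Hardy hierarchy. For $k\ge1$ and $\alpha\in OT_0$, $\alpha<\Omega$: $H_0(k)=k$; $H_{\alpha+1}(k)=H_\alpha(k)\cdot k$; if $tp(\lambda)=\omega$, $H_\lambda(k)=H_{\lambda\{k\}}(k)$ with $\lambda\{0\}=\lambda[0]$, $\lambda\{b+1\}=\lambda[H_{\lambda\{b\}}(k)]$. $k$-normal forms ($k\ge2$): each $m<k$ is its own $k$-normal form; for $m\ge k$ let $\alpha$ be the largest $\alpha\in OT_0$, $\alpha<\Omega$, with $H_\alpha(k)\le m$, and write $m=_kH_\alpha(k)\cdot p+q$ with $1\le p<k$, $q<H_\alpha(k)$; hereditarily, $q$ is in $k$-normal form and each term of $OT_0$ is written $\alpha_0+\dots+\alpha_n+l$ with principal $\alpha_i=\psi_j\beta$ and natural number $l$, where $l$ and recursively the $\beta$ are in $k$-normal form. Ordinal assignment ($k\ge2$): $o_k(m)=m$ for $m<k$; $o_k(k)=\omega$; $o_k(m)=\psi_0(o_k(\alpha))\cdot p+o_k(q)$ if $m=_kH_\alpha(k)\cdot p+q$; $o_k(0)=0$; $o_k(\alpha_0+\dots+\alpha_n+l)=o_k(\alpha_0)+\dots+o_k(\alpha_n)+o_k(l)$; $o_k(\psi_0\beta)=\psi_1(o_k(\beta))$; $o_k(\psi_1\beta)=\psi_2(o_k(\beta))$. -}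

module Defs where

open import Data.Nat using (ℕ; zero; suc; _+_; _*_; _≤_; _<_)
open import Data.List using (List; []; _∷_; _++_; replicate; length)
open import Data.List.Relation.Unary.All using (All)
open import Data.Product using (Σ; _×_)
open import Data.Sum using (_⊎_)
open import Data.Unit using (⊤)
open import Relation.Binary.PropositionalEquality using (_≡_)

-- A term is a finite list of principal terms:
--   []            represents 0,
--   p ∷ []        represents the principal term p,
--   p₀ ∷ … ∷ pₙ   (n ≥ 1) represents the sum p₀ + … + pₙ.
-- The side condition α₀ ≥ … ≥ αₙ on sums is imposed in OT (see below).

data Idx : Set where
  i0 i1 i2 : Idx

data _<ᴵ_ : Idx → Idx → Set where
  0<1 : i0 <ᴵ i1
  0<2 : i0 <ᴵ i2
  1<2 : i1 <ᴵ i2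

data Pr : Set where
  one : Pr
  ψ   : Idx → List Pr → Pr

Tm : Set
Tm = List Pr

num : ℕ → Tm
num n = replicate n one

ω Ω Ω₂ εΩ+1 : Tm
ω   = ψ i0 [] ∷ []
Ω   = ψ i1 [] ∷ []
Ω₂  = ψ i2 [] ∷ []
εΩ+1 = ψ i1 Ω₂ ∷ []

mutual
  data _<ᵀ_ : Tm → Tm → Set where
    nil<  : ∀ {p α} → [] <ᵀ (p ∷ α)
    head< : ∀ {p q α β} → p <ᴾ q → (p ∷ α) <ᵀ (q ∷ β)
    tail< : ∀ {p α β} → α <ᵀ β → (p ∷ α) <ᵀ (p ∷ β)

  data _<ᴾ_ : Pr → Pr → Set where
    one<ψ : ∀ {i α} → one <ᴾ ψ i α
    ψ<ψᵢ  : ∀ {i j α β} → i <ᴵ j → ψ i α <ᴾ ψ j β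
    ψ<ψₐ  : ∀ {i α β} → α <ᵀ β → ψ i α <ᴾ ψ i β

_≤ᵀ_ : Tm → Tm → Set
α ≤ᵀ β = α <ᵀ β ⊎ α ≡ β

_≤ᴾ_ : Pr → Pr → Set
p ≤ᴾ q = p <ᴾ q ⊎ p ≡ q

_<ˢ_ : List Tm → Tm → Set
A <ˢ β = All (_<ᵀ β) A

mutual
  G₁ : Tm → List Tm
  G₁ []      = []
  G₁ (p ∷ α) = G₁ᴾ p ++ G₁ α

  G₁ᴾ : Pr → List Tm
  G₁ᴾ one      = []
  G₁ᴾ (ψ i0 β) = []
  G₁ᴾ (ψ i1 β) = β ∷ G₁ β
  G₁ᴾ (ψ i2 β) = G₁ β

mutual
  G₀ : Tm → List Tm
  G₀ []      = []
  G₀ (p ∷ α) = G₀ᴾ p ++ G₀ α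

  G₀ᴾ : Pr → List Tm
  G₀ᴾ one      = []
  G₀ᴾ (ψ i0 β) = β ∷ G₀ β
  G₀ᴾ (ψ i1 β) = G₀ β
  G₀ᴾ (ψ i2 β) = G₀ β

HeadLeq : Tm → Pr → Set
HeadLeq []      p = ⊤
HeadLeq (q ∷ _) p = q ≤ᴾ p

mutual
  data OT : Tm → Set where
    ot[] : OT []
    ot∷  : ∀ {p α} → OTᴾ p → OT α → HeadLeq α p → OT (p ∷ α)

  data OTᴾ : Pr → Set where
    otOne : OTᴾ one
    otψ2  : ∀ {β} → OT β → OTᴾ (ψ i2 β)
    otψ1  : ∀ {β} → OT β → G₁ β <ˢ β → OTᴾ (ψ i1 β)
    otψ0  : ∀ {β} → OT β → G₀ β <ˢ β → β <ᵀ Ω₂ → OTᴾ (ψ i0 β)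

OT₀ : Tm → Set
OT₀ α = OT α × α <ᵀ εΩ+1 × G₀ α <ˢ εΩ+1

-- Fundamental sequences.  tp takes the values 0, 1, ω, Ω, Ω₂; t⊥ marks
-- the cases the paper leaves undefined (they do not occur for OT terms).

data Tp : Set where
  t0 t1 tω tΩ tΩ₂ t⊥ : Tp

Ωᵢ : Idx → Tp
Ωᵢ i0 = tω
Ωᵢ i1 = tΩ
Ωᵢ i2 = tΩ₂

tpψ : Idx → Tp → Tp
tpψ i  t0  = Ωᵢ i          -- α = 0 : ψᵢ0 = Ωᵢ
tpψ i  t1  = tω
tpψ i  tω  = tω
tpψ i0 tΩ  = tω
tpψ i1 tΩ  = tΩ
tpψ i2 tΩ  = tΩ
tpψ i0 tΩ₂ = t⊥
tpψ i1 tΩ₂ = tω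
tpψ i2 tΩ₂ = tΩ₂
tpψ i  t⊥  = t⊥

mutual
  tp : Tm → Tp
  tp []          = t0
  tp (p ∷ [])    = tpᴾ p
  tp (p ∷ q ∷ α) = tp (q ∷ α)

  tpᴾ : Pr → Tp
  tpᴾ one     = t1
  tpᴾ (ψ i α) = tpψ i (tp α)

-- the argument x of α[x] is itself a term (for tp α = Ω or Ω₂ it ranges
-- over ordinals); when x must be a natural number it is a numeral and
-- length recovers it.
mutual
  fs : Tm → Tm → Tm
  fs []          x = []
  fs (p ∷ [])    x = fsᴾ p x
  fs (p ∷ q ∷ α) x = p ∷ fs (q ∷ α) x

  fsᴾ : Pr → Tm → Tm
  fsᴾ one     x = []
  fsᴾ (ψ i α) x = fsψ i α (tp α) x

  fsψ : Idx → Tm → Tp → Tm → Tm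
  fsψ i  α t0  x = x
  fsψ i  α t1  x = replicate (length x) (ψ i (fs α []))
  fsψ i  α tω  x = ψ i (fs α x) ∷ []
  fsψ i0 α tΩ  x = ψ i0 (fs α (zs i0 α (length x))) ∷ []
  fsψ i1 α tΩ  x = ψ i1 (fs α x) ∷ []
  fsψ i2 α tΩ  x = ψ i2 (fs α x) ∷ []
  fsψ i0 α tΩ₂ x = []                                  -- undefined case
  fsψ i1 α tΩ₂ x = ψ i1 (fs α (zs i1 α (length x))) ∷ []
  fsψ i2 α tΩ₂ x = ψ i2 (fs α x) ∷ []
  fsψ i  α t⊥  x = []                                  -- undefined case

  zs : Idx → Tm → ℕ → Tm
  zs i α zero    = []
  zs i α (suc n) = ψ i (fs α (zs i α n)) ∷ []

_[_] : Tm → ℕ → Tm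
α [ n ] = fs α (num n)

-- Hardy hierarchy, as the graph of H: Hardy k α n  means  H_α(k) = n.
-- Brace k λ b μ  means  λ{b} = μ  (with respect to k).

mutual
  data Hardy (k : ℕ) : Tm → ℕ → Set where
    H0   : Hardy k [] k
    Hsuc : ∀ {α n} → Hardy k α n → Hardy k (α ++ one ∷ []) (n * k)
    Hlim : ∀ {l μ n} → tp l ≡ tω → Brace k l k μ → Hardy k μ n → Hardy k l n

  data Brace (k : ℕ) (l : Tm) : ℕ → Tm → Set where
    B0 : Brace k l 0 (l [ 0 ])
    Bs : ∀ {b μ h} → Brace k l b μ → Hardy k μ h → Brace k l (suc b) (l [ h ])

Largest : ℕ → ℕ → Tm → Set
Largest k m α =
  (OT₀ α × α <ᵀ Ω × Σ ℕ (λ h → Hardy k α h × h ≤ m)) ×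
  (∀ α' h' → OT₀ α' → α' <ᵀ Ω → Hardy k α' h' → h' ≤ m → α' ≤ᵀ α)

-- Ordinal assignment o_k, as a relation (graph of o_k):
--   OkN k m γ : o_k(m) = γ   for natural numbers m
--   OkT k α γ : o_k(α) = γ   for terms α (in k-normal form)

mutual
  data OkN (k : ℕ) : ℕ → Tm → Set where
    okSmall : ∀ {m} → m < k → OkN k m (num m)
    okK     : OkN k k ω
    okBig   : ∀ {m α p q h a b} → k < m → Largest k m α →
              Hardy k α h → 1 ≤ p → p < k → q < h → m ≡ h * p + q →
              OkT k α a → OkN k q b →
              OkN k m (replicate p (ψ i0 a) ++ b)

  data OkT (k : ℕ) : Tm → Tm → Set where
    okNum : ∀ {l γ} → OkN k l γ → OkT k (num l) γ
    okψ0  : ∀ {β α γ δ} → OkT k β γ → OkT k α δ → OkT k (ψ i0 β ∷ α) (ψ i1 γ ∷ δ)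
    okψ1  : ∀ {β α γ δ} → OkT k β γ → OkT k α δ → OkT k (ψ i1 β ∷ α) (ψ i2 γ ∷ δ)

{-# OPTIONS --safe #-}
-- o_k is strictly increasing on every term it is defined on; this is proved by
-- simultaneous induction with the normal-form fact that a remainder q < H_α(k)
-- is sent below ψ₀(o_k α).  Moreover o_k turns ψ₀ into ψ₁, ψ₁ into ψ₂ and
-- numbers into terms below Ω, so G₁(o_k α) is o_k applied elementwise to G₀ α.
-- Each element of G₁(o_k α) is therefore o_k ξ for some ξ < β, hence below
-- o_k β.
module Submission where

open import Defs
open import Data.Nat using (ℕ; zero; suc; _+_; _*_; _≤_; _<_; z≤n; s≤s)
open import Data.Nat.Properties
open import Data.List using ([]; _∷_; _++_; _∷ʳ_; replicate)
open import Data.List.Properties using (∷-injectiveʳ; ∷ʳ-injectiveˡ; ++-conicalʳ)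
open import Data.List.Relation.Unary.All using (All; []; _∷_)
open import Data.List.Relation.Binary.Pointwise using (Pointwise; []; _∷_; ++⁺)
open import Data.Sum using (_⊎_; inj₁; inj₂)
open import Data.Product using (_,_; _×_)
open import Data.Empty using (⊥; ⊥-elim)
open import Relation.Binary.PropositionalEquality
  using (_≡_; _≢_; refl; sym; trans; cong; cong₂; subst; subst₂)
open import Relation.Binary.Definitions using (tri<; tri≈; tri>)

<ᴵ-irrefl : ∀ {i} → i <ᴵ i → ⊥
<ᴵ-irrefl ()

<ᴵ-asym : ∀ {i j} → i <ᴵ j → j <ᴵ i → ⊥
<ᴵ-asym 0<1 ()
<ᴵ-asym 0<2 ()
<ᴵ-asym 1<2 ()

mutual
  <ᵀ-irrefl : ∀ {α} → α <ᵀ α → ⊥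
  <ᵀ-irrefl (head< p<p) = <ᴾ-irrefl p<p
  <ᵀ-irrefl (tail< α<α) = <ᵀ-irrefl α<α

  <ᴾ-irrefl : ∀ {p} → p <ᴾ p → ⊥
  <ᴾ-irrefl (ψ<ψᵢ i<i) = <ᴵ-irrefl i<i
  <ᴾ-irrefl (ψ<ψₐ α<α) = <ᵀ-irrefl α<α

mutual
  <ᵀ-asym : ∀ {α β} → α <ᵀ β → β <ᵀ α → ⊥
  <ᵀ-asym nil< ()
  <ᵀ-asym (head< p<q) (head< q<p) = <ᴾ-asym p<q q<p
  <ᵀ-asym (head< p<p) (tail< _)   = <ᴾ-irrefl p<p
  <ᵀ-asym (tail< _)   (head< p<p) = <ᴾ-irrefl p<p
  <ᵀ-asym (tail< α<β) (tail< β<α) = <ᵀ-asym α<β β<α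

  <ᴾ-asym : ∀ {p q} → p <ᴾ q → q <ᴾ p → ⊥
  <ᴾ-asym one<ψ ()
  <ᴾ-asym (ψ<ψᵢ i<j) (ψ<ψᵢ j<i) = <ᴵ-asym i<j j<i
  <ᴾ-asym (ψ<ψᵢ i<i) (ψ<ψₐ _)   = <ᴵ-irrefl i<i
  <ᴾ-asym (ψ<ψₐ _)   (ψ<ψᵢ i<i) = <ᴵ-irrefl i<i
  <ᴾ-asym (ψ<ψₐ α<β) (ψ<ψₐ β<α) = <ᵀ-asym α<β β<α

≤ᵀ-antisym : ∀ {α β} → α ≤ᵀ β → β ≤ᵀ α → α ≡ β
≤ᵀ-antisym (inj₂ α≡β) _          = α≡β
≤ᵀ-antisym (inj₁ _)   (inj₂ β≡α) = sym β≡α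
≤ᵀ-antisym (inj₁ α<β) (inj₁ β<α) = ⊥-elim (<ᵀ-asym α<β β<α)

++-monoʳ-<ᵀ : ∀ xs {β β'} → β <ᵀ β' → (xs ++ β) <ᵀ (xs ++ β')
++-monoʳ-<ᵀ []       β<β' = β<β'
++-monoʳ-<ᵀ (_ ∷ xs) β<β' = tail< (++-monoʳ-<ᵀ xs β<β')

replicate-++-<ᵀ : ∀ {p p' x β β'} → p < p' → (∀ {γ} → β <ᵀ (x ∷ γ)) →
                  (replicate p x ++ β) <ᵀ (replicate p' x ++ β')
replicate-++-<ᵀ {zero}  {suc _} _           β<x = β<x
replicate-++-<ᵀ {suc _} {suc _} (s≤s p<p') β<x = tail< (replicate-++-<ᵀ p<p' β<x)

num-mono-< : ∀ {l l'} → l < l' → num l <ᵀ num l'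
num-mono-< {zero}  {suc _} _          = nil<
num-mono-< {suc _} {suc _} (s≤s l<l') = tail< (num-mono-< l<l')

num-cancel-< : ∀ l l' → num l <ᵀ num l' → l < l'
num-cancel-< zero    (suc _)  _           = s≤s z≤n
num-cancel-< (suc l) (suc l') (tail< l<l') = s≤s (num-cancel-< l l' l<l')

num-injective : ∀ l l' → num l ≡ num l' → l ≡ l'
num-injective zero    zero     _ = refl
num-injective (suc l) (suc l') e = cong suc (num-injective l l' (∷-injectiveʳ e))

num<ψ : ∀ l {i β γ} → num l <ᵀ (ψ i β ∷ γ)
num<ψ zero    = nil<
num<ψ (suc _) = head< one<ψ

ψ≮num : ∀ l {i β γ} → (ψ i β ∷ γ) <ᵀ num l → ⊥
ψ≮num (suc _) (head< ())

*+-mono-< : ∀ {h p q p' q'} → q < h → p < p' → h * p + q < h * p' + q'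
*+-mono-< {h} {p} {q} {p'} {q'} q<h p<p' = begin-strict
  h * p + q   <⟨ +-monoʳ-< (h * p) q<h ⟩
  h * p + h   ≡⟨ +-comm (h * p) h ⟩
  h + h * p   ≡⟨ *-suc h p ⟨
  h * suc p   ≤⟨ *-monoʳ-≤ h p<p' ⟩
  h * p'      ≤⟨ m≤m+n (h * p') q' ⟩
  h * p' + q' ∎
  where open ≤-Reasoning

*+-cancel-< : ∀ {h p q p' q'} → q < h → q' < h → h * p + q < h * p' + q' →
              p < p' ⊎ (p ≡ p' × q < q')
*+-cancel-< {h} {p} {q} {p'} {q'} _ q'<h lt with <-cmp p p'
... | tri< p<p' _ _ = inj₁ p<p'
... | tri≈ _ refl _ = inj₂ (refl , +-cancelˡ-< (h * p) q q' lt)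
... | tri> _ _ p'<p = ⊥-elim (<-asym lt (*+-mono-< q'<h p'<p))

*+-injective : ∀ {h p q p' q'} → q < h → q' < h → h * p + q ≡ h * p' + q' →
               p ≡ p' × q ≡ q'
*+-injective {h} {p} {q} {p'} {q'} q<h q'<h e with <-cmp p p'
... | tri< p<p' _ _ = ⊥-elim (<-irrefl e (*+-mono-< q<h p<p'))
... | tri≈ _ refl _ = refl , +-cancelˡ-≡ (h * p) q q' e
... | tri> _ _ p'<p = ⊥-elim (<-irrefl (sym e) (*+-mono-< q'<h p'<p))

tp-∷ʳ-one : ∀ α → tp (α ∷ʳ one) ≡ t1
tp-∷ʳ-one []          = refl
tp-∷ʳ-one (_ ∷ [])    = refl
tp-∷ʳ-one (_ ∷ q ∷ α) = tp-∷ʳ-one (q ∷ α)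

∷ʳ-one≢[] : ∀ α → α ∷ʳ one ≢ []
∷ʳ-one≢[] α e with ++-conicalʳ α _ e
... | ()

∷ʳ-one-not-limit : ∀ α → tp (α ∷ʳ one) ≢ tω
∷ʳ-one-not-limit α e with trans (sym (tp-∷ʳ-one α)) e
... | ()

-- The index equations are explicit: indices such as α ∷ʳ one and num l do not unify.
mutual
  Hardy-functional : ∀ {k α α' h h'} → Hardy k α h → Hardy k α' h' → α ≡ α' → h ≡ h'
  Hardy-functional H0 H0 _ = refl
  Hardy-functional H0 (Hsuc {α} _) e = ⊥-elim (∷ʳ-one≢[] α (sym e))
  Hardy-functional H0 (Hlim () _ _) refl
  Hardy-functional (Hsuc {α} _) H0 e = ⊥-elim (∷ʳ-one≢[] α e)
  Hardy-functional {k} (Hsuc H) (Hsuc H') e =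
    cong (_* k) (Hardy-functional H H' (∷ʳ-injectiveˡ _ _ e))
  Hardy-functional (Hsuc {α} _) (Hlim lim _ _) refl = ⊥-elim (∷ʳ-one-not-limit α lim)
  Hardy-functional (Hlim () _ _) H0 refl
  Hardy-functional (Hlim lim _ _) (Hsuc {α} _) refl = ⊥-elim (∷ʳ-one-not-limit α lim)
  Hardy-functional (Hlim _ B H) (Hlim _ B' H') refl =
    Hardy-functional H H' (Brace-functional B B')

  Brace-functional : ∀ {k l b μ μ'} → Brace k l b μ → Brace k l b μ' → μ ≡ μ'
  Brace-functional B0 B0 = refl
  Brace-functional {l = l} (Bs B H) (Bs B' H') =
    cong (l [_]) (Hardy-functional H H' (Brace-functional B B'))

Largest-mono : ∀ {k m m' α α'} → Largest k m α → Largest k m' α' → m ≤ m' → α ≤ᵀ α'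
Largest-mono ((ot₀ , α<Ω , h , H , h≤m) , _) (_ , maximal') m≤m' =
  maximal' _ h ot₀ α<Ω H (≤-trans h≤m m≤m')

Largest-unique : ∀ {k m α α'} → Largest k m α → Largest k m α' → α ≡ α'
Largest-unique L L' = ≤ᵀ-antisym (Largest-mono L L' ≤-refl) (Largest-mono L' L ≤-refl)

mutual
  OkT-functional : ∀ {k α α' γ γ'} → OkT k α γ → OkT k α' γ' → α ≡ α' → γ ≡ γ'
  OkT-functional (okNum {l} D) (okNum {l'} D') e = OkN-functional D D' (num-injective l l' e)
  OkT-functional (okNum {zero} _)  (okψ0 _ _) ()
  OkT-functional (okNum {suc _} _) (okψ0 _ _) ()
  OkT-functional (okNum {zero} _)  (okψ1 _ _) ()
  OkT-functional (okNum {suc _} _) (okψ1 _ _) ()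
  OkT-functional (okψ0 _ _) (okNum {zero} _)  ()
  OkT-functional (okψ0 _ _) (okNum {suc _} _) ()
  OkT-functional (okψ1 _ _) (okNum {zero} _)  ()
  OkT-functional (okψ1 _ _) (okNum {suc _} _) ()
  OkT-functional (okψ0 B A) (okψ0 B' A') refl =
    cong₂ (λ γ δ → ψ i1 γ ∷ δ) (OkT-functional B B' refl) (OkT-functional A A' refl)
  OkT-functional (okψ1 B A) (okψ1 B' A') refl =
    cong₂ (λ γ δ → ψ i2 γ ∷ δ) (OkT-functional B B' refl) (OkT-functional A A' refl)
  OkT-functional (okψ0 _ _) (okψ1 _ _) ()
  OkT-functional (okψ1 _ _) (okψ0 _ _) ()

  OkN-functional : ∀ {k m m' γ γ'} → OkN k m γ → OkN k m' γ' → m ≡ m' → γ ≡ γ'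
  OkN-functional (okSmall _) (okSmall _) refl = refl
  OkN-functional (okSmall m<k) okK refl = ⊥-elim (<-irrefl refl m<k)
  OkN-functional (okSmall m<k) (okBig k<m _ _ _ _ _ _ _ _) refl = ⊥-elim (<-asym m<k k<m)
  OkN-functional okK (okSmall k<k) refl = ⊥-elim (<-irrefl refl k<k)
  OkN-functional okK okK refl = refl
  OkN-functional okK (okBig k<k _ _ _ _ _ _ _ _) refl = ⊥-elim (<-irrefl refl k<k)
  OkN-functional (okBig k<m _ _ _ _ _ _ _ _) (okSmall m<k) refl = ⊥-elim (<-asym m<k k<m)
  OkN-functional (okBig k<k _ _ _ _ _ _ _ _) okK refl = ⊥-elim (<-irrefl refl k<k)
  OkN-functional (okBig _ L H _ _ q<h e A Q) (okBig _ L' H' _ _ q'<h e' A' Q') refl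
    with Largest-unique L L'
  ... | refl with Hardy-functional H H' refl
  ... | refl with *+-injective q<h q'<h (trans (sym e) e')
  ... | refl , refl =
    cong₂ (λ a b → replicate _ (ψ i0 a) ++ b)
          (OkT-functional A A' refl) (OkN-functional Q Q' refl)

OkN-positive : ∀ {k m γ} → OkN k m γ → 0 < m → [] <ᵀ γ
OkN-positive (okSmall {suc _} _) _ = nil<
OkN-positive okK _ = nil<
OkN-positive (okBig _ _ _ (s≤s z≤n) _ _ _ _ _) _ = nil<

OkT-positive : ∀ {k α γ} → OkT k α γ → [] <ᵀ α → [] <ᵀ γ
OkT-positive (okNum {suc _} D) _ = OkN-positive D (s≤s z≤n)
OkT-positive (okψ0 _ _) _ = nil<
OkT-positive (okψ1 _ _) _ = nil<

OkT-zero : ∀ {k α} → OkT k α [] → α ≡ []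
OkT-zero {α = []}    _ = refl
OkT-zero {α = _ ∷ _} A with OkT-positive A nil<
... | ()

OkN<ψ : ∀ {k m γ j β δ} → i0 <ᴵ j → OkN k m γ → γ <ᵀ (ψ j β ∷ δ)
OkN<ψ _   (okSmall {m} _) = num<ψ m
OkN<ψ 0<j okK = head< (ψ<ψᵢ 0<j)
OkN<ψ 0<j (okBig _ _ _ (s≤s z≤n) _ _ _ _ _) = head< (ψ<ψᵢ 0<j)

-- ω = ψ₀0, and o_k(m) = ψ₀(0)·p + o_k(q) means m = H₀(k)·p + q = k·p + q,
-- which exceeds k only if p ≥ 2 or q > 0.
ω<OkN : ∀ {k m γ} → k < m → OkN k m γ → ω <ᵀ γ
ω<OkN k<m (okSmall m<k) = ⊥-elim (<-asym k<m m<k)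
ω<OkN k<k okK = ⊥-elim (<-irrefl refl k<k)
ω<OkN _ (okBig {a = _ ∷ _} _ _ _ (s≤s z≤n) _ _ _ _ _) = head< (ψ<ψₐ nil<)
ω<OkN _ (okBig {p = suc (suc _)} {a = []} _ _ _ _ _ _ _ _ _) = tail< nil<
ω<OkN _ (okBig {p = 1} {q = suc _} {a = []} _ _ _ _ _ _ _ _ Q) = tail< (OkN-positive Q (s≤s z≤n))
ω<OkN k<m (okBig {p = 1} {q = zero} {a = []} _ _ H _ _ _ m≡h*1+0 A _) with OkT-zero A
... | refl with Hardy-functional H H0 refl
... | refl =
  ⊥-elim (<-irrefl (sym (trans m≡h*1+0 (trans (+-identityʳ _) (*-identityʳ _)))) k<m)

mutual
  OkT-mono : ∀ {k α α' γ γ'} → OkT k α γ → OkT k α' γ' → α <ᵀ α' → γ <ᵀ γ'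
  OkT-mono (okNum {l} D) (okNum {l'} D') lt = OkN-mono D D' (num-cancel-< l l' lt)
  OkT-mono (okNum D) (okψ0 _ _) _ = OkN<ψ 0<1 D
  OkT-mono (okNum D) (okψ1 _ _) _ = OkN<ψ 0<2 D
  OkT-mono (okψ0 _ _) (okNum {l} _) lt = ⊥-elim (ψ≮num l lt)
  OkT-mono (okψ1 _ _) (okNum {l} _) lt = ⊥-elim (ψ≮num l lt)
  OkT-mono (okψ0 B _) (okψ0 B' _) (head< (ψ<ψₐ β<β')) = head< (ψ<ψₐ (OkT-mono B B' β<β'))
  OkT-mono (okψ0 B A) (okψ0 B' A') (tail< α<α') with OkT-functional B B' refl
  ... | refl = tail< (OkT-mono A A' α<α')
  OkT-mono (okψ1 B _) (okψ1 B' _) (head< (ψ<ψₐ β<β')) = head< (ψ<ψₐ (OkT-mono B B' β<β'))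
  OkT-mono (okψ1 B A) (okψ1 B' A') (tail< α<α') with OkT-functional B B' refl
  ... | refl = tail< (OkT-mono A A' α<α')
  OkT-mono (okψ0 _ _) (okψ1 _ _) _ = head< (ψ<ψᵢ 1<2)
  OkT-mono (okψ0 _ _) (okψ0 _ _) (head< (ψ<ψᵢ ()))
  OkT-mono (okψ1 _ _) (okψ1 _ _) (head< (ψ<ψᵢ ()))
  OkT-mono (okψ1 _ _) (okψ0 _ _) (head< (ψ<ψᵢ ()))

  OkN-remainder<ψ₀ : ∀ {k m α h a q γ δ} → Largest k m α → Hardy k α h → OkT k α a →
                     q < h → q ≤ m → OkN k q γ → γ <ᵀ (ψ i0 a ∷ δ)
  OkN-remainder<ψ₀ _ _ _ _ _ (okSmall {q} _) = num<ψ q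
  OkN-remainder<ψ₀ {α = []} _ H _ k<h _ okK = ⊥-elim (<-irrefl (Hardy-functional H0 H refl) k<h)
  OkN-remainder<ψ₀ {α = _ ∷ _} _ _ A _ _ okK = head< (ψ<ψₐ (OkT-positive A nil<))
  OkN-remainder<ψ₀ L H A q<h q≤m
    (okBig _ L'@((_ , _ , _ , H' , h'≤q) , _) _ (s≤s z≤n) _ _ _ A' _)
    with Largest-mono L' L q≤m
  ... | inj₁ α'<α = head< (ψ<ψₐ (OkT-mono A' A α'<α))
  ... | inj₂ refl = ⊥-elim (<⇒≱ q<h (subst (_≤ _) (Hardy-functional H' H refl) h'≤q))

  OkN-mono : ∀ {k m m' γ γ'} → OkN k m γ → OkN k m' γ' → m < m' → γ <ᵀ γ'
  OkN-mono (okSmall _) (okSmall _) m<m' = num-mono-< m<m'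
  OkN-mono (okSmall {m} _) okK _ = num<ψ m
  OkN-mono (okSmall {m} _) (okBig _ _ _ (s≤s z≤n) _ _ _ _ _) _ = num<ψ m
  OkN-mono okK (okSmall m'<k) k<m' = ⊥-elim (<-asym k<m' m'<k)
  OkN-mono okK okK k<k = ⊥-elim (<-irrefl refl k<k)
  OkN-mono okK D k<m' = ω<OkN k<m' D
  OkN-mono (okBig k<m _ _ _ _ _ _ _ _) (okSmall m'<k) m<m' =
    ⊥-elim (<-asym (<-trans k<m m<m') m'<k)
  OkN-mono (okBig k<m _ _ _ _ _ _ _ _) okK m<k = ⊥-elim (<-asym k<m m<k)
  OkN-mono (okBig {p = p} {q} _ L H (s≤s z≤n) _ q<h m≡ A Q)
           (okBig _ L' H' (s≤s z≤n) _ q'<h m'≡ A' Q') m<m'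
    with Largest-mono L L' (<⇒≤ m<m')
  ... | inj₁ α<α' = head< (ψ<ψₐ (OkT-mono A A' α<α'))
  ... | inj₂ refl with OkT-functional A A' refl | Hardy-functional H H' refl
  ... | refl | refl with *+-cancel-< q<h q'<h (subst₂ _<_ m≡ m'≡ m<m')
  ... | inj₁ p<p' =
    replicate-++-<ᵀ p<p' (OkN-remainder<ψ₀ L H A q<h (subst (q ≤_) (sym m≡) (m≤n+m q _)) Q)
  ... | inj₂ (refl , q<q') = ++-monoʳ-<ᵀ (replicate p _) (OkN-mono Q Q' q<q')

G₀-num : ∀ l → G₀ (num l) ≡ []
G₀-num zero    = refl
G₀-num (suc l) = G₀-num l

G₁-num : ∀ l → G₁ (num l) ≡ []
G₁-num zero    = refl
G₁-num (suc l) = G₁-num l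

G₁-replicate-ψ₀-++ : ∀ p a β → G₁ (replicate p (ψ i0 a) ++ β) ≡ G₁ β
G₁-replicate-ψ₀-++ zero    _ _ = refl
G₁-replicate-ψ₀-++ (suc p) a β = G₁-replicate-ψ₀-++ p a β

G₁-OkN : ∀ {k m γ} → OkN k m γ → G₁ γ ≡ []
G₁-OkN (okSmall {m} _) = G₁-num m
G₁-OkN okK = refl
G₁-OkN (okBig {p = p} {a = a} {b = b} _ _ _ _ _ _ _ _ Q) =
  trans (G₁-replicate-ψ₀-++ p a b) (G₁-OkN Q)

G₁-OkT : ∀ {k α γ} → OkT k α γ → Pointwise (OkT k) (G₀ α) (G₁ γ)
G₁-OkT (okNum {l} D) rewrite G₀-num l | G₁-OkN D = []
G₁-OkT (okψ0 B A) = B ∷ ++⁺ (G₁-OkT B) (G₁-OkT A)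
G₁-OkT (okψ1 B A) = ++⁺ (G₁-OkT B) (G₁-OkT A)

All-Pointwise : ∀ {a b p q r} {A : Set a} {B : Set b}
                  {P : A → Set p} {Q : B → Set q} {R : A → B → Set r} →
                (∀ {x y} → R x y → P x → Q y) →
                ∀ {xs ys} → Pointwise R xs ys → All P xs → All Q ys
All-Pointwise _   []         []         = []
All-Pointwise transport (Rxy ∷ Rs) (Px ∷ Ps) = transport Rxy Px ∷ All-Pointwise transport Rs Ps

mainTheorem11 : (k : ℕ) → 2 ≤ k → (α β γ δ : Tm) →
    OT₀ α → OT₀ β → G₀ α <ˢ β →
    OkT k α γ → OkT k β δ →
    G₁ γ <ˢ δ
mainTheorem11 k _ α β γ δ _ _ G₀α<β α↦γ β↦δ =
  All-Pointwise (λ ξ↦ζ ξ<β → OkT-mono ξ↦ζ β↦δ ξ<β) (G₁-OkT α↦γ) G₀α<β
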